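{- Let $2\le n_1\le\cdots\le n_l$ be integers and $n=\sum_{i=1}^l n_i$. If a graph $G$ contains an $(n,1)$-weak ladder and there exists $i\in[l]$ with $n_i>2$, then $G$ contains vertex-disjoint cycles $C_{2n_1},C_{2n_2},\dots,C_{2n_l}$.
   Context: An $n$-ladder $L_n$ is the balanced bipartite graph with parts $A=\{a_1,\dots,a_n\}$, $B=\{b_1,\dots,b_n\}$ in which $a_ib_j$ is an edge iff $|i-j|\le1$; the edges $a_ib_i$ are its rungs, $a_1b_1$ the first rung. Let $L_{n_1},L_{n_2}$ be two vertex-disjoint ladders in $G$ with $n_1\le n_2$ and first rungs $\{a_1,b_1\}$ and $\{a_1',b_1'\}$ respectively. If there exist an $a_1$–$a_1'$ path $P_1$ and a $b_1$–$b_1'$ path $P_2$ whose sets of interior vertices $\mathring P_1,\mathring P_2$ are disjoint from each other and from $L_{n_1}\cup L_{n_2}$, with $|\mathring P_1|+|\mathring P_2|=2k$, then $L_{n_1}\cup L_{n_2}\cup P_1\cup P_2$ is called an $(n_1+n_2,k)$-weak ladder. $C_m$ is the cycle on $m$ vertices. -}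

module Defs where

open import Data.Nat using (ℕ; zero; suc; _+_; _*_; _≤_; _<_)
open import Data.Fin using (Fin; zero; suc; toℕ; inject₁; fromℕ)
open import Data.Product using (Σ; ∃; _×_; _,_)
open import Data.Sum using (_⊎_)
open import Data.Empty using (⊥)
open import Relation.Binary.PropositionalEquality using (_≡_)
open import Function.Definitions using (Injective)

record SimpleGraph (N : ℕ) : Set₁ where
  field
    Adj     : Fin N → Fin N → Set
    symm    : ∀ {u v} → Adj u v → Adj v u
    irrefl  : ∀ {u} → Adj u u → ⊥
open SimpleGraph public

sumFin : ∀ {l} → (Fin l → ℕ) → ℕ
sumFin {zero}  f = 0
sumFin {suc l} f = f zero + sumFin (λ i → f (suc i))

-- The abstract (n1+n2,k)-weak ladder graph, with n1 = suc m1, n2 = suc m2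
-- (ladders have at least one rung, the first rung being index zero),
-- and p, q the numbers of interior vertices of the paths P1, P2.

data WLVertex (m1 m2 p q : ℕ) : Set where
  a  b  : Fin (suc m1) → WLVertex m1 m2 p q
  a' b' : Fin (suc m2) → WLVertex m1 m2 p q
  x     : Fin p → WLVertex m1 m2 p q
  y     : Fin q → WLVertex m1 m2 p q

Near : ∀ {n} → Fin n → Fin n → Set
Near i j = (toℕ i ≡ toℕ j) ⊎ (suc (toℕ i) ≡ toℕ j) ⊎ (toℕ i ≡ suc (toℕ j))

-- Edges of the weak ladder (each listed in one orientation).
data WLEdge {m1 m2 p q : ℕ} : WLVertex m1 m2 p q → WLVertex m1 m2 p q → Set where
  ladder₁ : ∀ i j → Near i j → WLEdge (a i) (b j)
  ladder₂ : ∀ i j → Near i j → WLEdge (a' i) (b' j)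
  path₁-empty : p ≡ 0 → WLEdge (a zero) (a' zero)
  path₁-first : ∀ (i : Fin p) → toℕ i ≡ 0 → WLEdge (a zero) (x i)
  path₁-step  : ∀ (i j : Fin p) → suc (toℕ i) ≡ toℕ j → WLEdge (x i) (x j)
  path₁-last  : ∀ (i : Fin p) → suc (toℕ i) ≡ p → WLEdge (x i) (a' zero)
  path₂-empty : q ≡ 0 → WLEdge (b zero) (b' zero)
  path₂-first : ∀ (i : Fin q) → toℕ i ≡ 0 → WLEdge (b zero) (y i)
  path₂-step  : ∀ (i j : Fin q) → suc (toℕ i) ≡ toℕ j → WLEdge (y i) (y j)
  path₂-last  : ∀ (i : Fin q) → suc (toℕ i) ≡ q → WLEdge (y i) (b' zero)

ContainsWeakLadder : ∀ {N} → SimpleGraph N → ℕ → ℕ → Set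
ContainsWeakLadder {N} G n k =
  Σ ℕ λ m1 → Σ ℕ λ m2 → Σ ℕ λ p → Σ ℕ λ q →
    (suc m1 ≤ suc m2) × (suc m1 + suc m2 ≡ n) × (p + q ≡ 2 * k) ×
    Σ (WLVertex m1 m2 p q → Fin N) λ f →
      Injective _≡_ _≡_ f ×
      (∀ {u v} → WLEdge u v → Adj G (f u) (f v))

CycleEdge : (m : ℕ) → Fin m → Fin m → Set
CycleEdge m j k = (suc (toℕ j) ≡ toℕ k) ⊎ ((suc (toℕ j) ≡ m) × (toℕ k ≡ 0))

-- G contains vertex-disjoint cycles C_{len 0}, ..., C_{len (l-1)}:
-- one injective map from the disjoint union of their vertex sets,
-- sending cycle edges to edges of G.
ContainsDisjointCycles : ∀ {N} → SimpleGraph N → ∀ {l} → (Fin l → ℕ) → Set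
ContainsDisjointCycles {N} G {l} len =
  Σ (Σ (Fin l) (λ i → Fin (len i)) → Fin N) λ f →
    Injective _≡_ _≡_ f ×
    (∀ i j k → CycleEdge (len i) j k → Adj G (f (i , j)) (f (i , k)))

-- Place C_{2n_1}, …, C_{2n_{l-1}} greedily on blocks of consecutive rungs taken from the far
-- ends of the two ladders: k consecutive rungs carry a C_{2k}, which goes up the rungs on
-- alternating sides and comes back down on the opposite ones. This never gets stuck: if both
-- ladders had fewer than n_i rungs left, the at least n_i + n_l ≥ 2n_i remaining rungs would be
-- fewer than 2n_i. The longest cycle C_{2n_l} is placed last, on all n_l remaining rungs. If one
-- ladder is used up it is again such a zigzag; otherwise it runs up and down the first s rungs of
-- L_{n_1}, along P₂, up and down the first t rungs of L_{n_2} and back along P₁, which has length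
-- 2s + 2t + 2, and n_l > 2 leaves room for s + t = n_l - 1 with s, t ≥ 1.

module Submission where

open import Defs
open import Data.Bool using (Bool; true; false; not)
open import Data.Bool.Properties using (not-¬)
open import Data.Empty using (⊥; ⊥-elim)
open import Data.Unit using (⊤; tt)
open import Data.Fin using (Fin; zero; suc; toℕ; fromℕ; fromℕ<; opposite; _↑ˡ_; _↑ʳ_; splitAt)
open import Data.Fin.Properties
  using (toℕ-injective; toℕ<n; toℕ-fromℕ<; toℕ-↑ˡ; toℕ-↑ʳ; opposite-prop; opposite-involutive; ≤fromℕ)
open import Data.Nat using (ℕ; zero; suc; _+_; _*_; _∸_; _≤_; _<_; z≤n; s≤s; z<s; _≤?_)
open import Data.Nat.Properties
open import Data.Product using (Σ; ∃; ∃₂; _×_; _,_; proj₂)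
open import Data.Sum using (_⊎_; inj₁; inj₂)
open import Data.Vec.Functional using (Vector; _++_; reverse)
open import Data.Vec.Functional.Properties using (lookup-++ˡ; lookup-++ʳ)
open import Data.Nat.Tactic.RingSolver using (solve-∀)
open import Function.Definitions using (Injective)
open import Relation.Binary.PropositionalEquality
open import Relation.Nullary using (yes; no)
open import Relation.Unary using (_⊆_; _∪_)

data Split (m n : ℕ) : Fin (m + n) → Set where
  left  : (i : Fin m) → Split m n (i ↑ˡ n)
  right : (j : Fin n) → Split m n (m ↑ʳ j)

split : ∀ m {n} (i : Fin (m + n)) → Split m n i
split zero    i       = right i
split (suc m) zero    = left zero
split (suc m) (suc i) with split m i
... | left i′  = left (suc i′)
... | right j  = right j

first⇒opposite-last : ∀ {m} (i : Fin m) → toℕ i ≡ 0 → suc (toℕ (opposite i)) ≡ m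
first⇒opposite-last {m} i i≡0 = begin
  suc (toℕ (opposite i)) ≡⟨ cong suc (opposite-prop i) ⟩
  suc (m ∸ suc (toℕ i))  ≡⟨ cong (λ t → suc (m ∸ suc t)) i≡0 ⟩
  suc (m ∸ 1)            ≡⟨ m+[n∸m]≡n (≤-trans (s≤s z≤n) (toℕ<n i)) ⟩
  m ∎
  where open ≡-Reasoning

last⇒opposite-first : ∀ {m} (i : Fin m) → suc (toℕ i) ≡ m → toℕ (opposite i) ≡ 0
last⇒opposite-first {m} i i-last = trans (opposite-prop i) (trans (cong (m ∸_) i-last) (n∸n≡0 m))

opposite-step : ∀ {m} {i j : Fin m} → suc (toℕ i) ≡ toℕ j → suc (toℕ (opposite j)) ≡ toℕ (opposite i)
opposite-step {m} {i} {j} i→j = begin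
  suc (toℕ (opposite j))  ≡⟨ cong suc (opposite-prop j) ⟩
  suc (m ∸ suc (toℕ j))   ≡⟨ +-∸-assoc 1 (toℕ<n j) ⟨
  m ∸ toℕ j               ≡⟨ cong (m ∸_) i→j ⟨
  m ∸ suc (toℕ i)         ≡⟨ opposite-prop i ⟨
  toℕ (opposite i)        ∎
  where open ≡-Reasoning

↑ˡ-step : ∀ {m n} (i j : Fin m) → suc (toℕ (i ↑ˡ n)) ≡ toℕ (j ↑ˡ n) → suc (toℕ i) ≡ toℕ j
↑ˡ-step {n = n} i j i→j = trans (cong suc (sym (toℕ-↑ˡ i n))) (trans i→j (toℕ-↑ˡ j n))

↑ʳ-step : ∀ {m n} (i j : Fin n) → suc (toℕ (m ↑ʳ i)) ≡ toℕ (m ↑ʳ j) → suc (toℕ i) ≡ toℕ j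
↑ʳ-step {m} i j i→j = +-cancelˡ-≡ m _ _
  (trans (+-suc m (toℕ i)) (trans (cong suc (sym (toℕ-↑ʳ m i))) (trans i→j (toℕ-↑ʳ m j))))

seam-step : ∀ {m n} (i : Fin m) (j : Fin n) → suc (toℕ (i ↑ˡ n)) ≡ toℕ (m ↑ʳ j) →
  suc (toℕ i) ≡ m × toℕ j ≡ 0
seam-step {m} {n} i j i→j = trans i→m+j (trans (cong (m +_) j≡0) (+-identityʳ m)) , j≡0
  where
    i→m+j : suc (toℕ i) ≡ m + toℕ j
    i→m+j = trans (cong suc (sym (toℕ-↑ˡ i n))) (trans i→j (toℕ-↑ʳ m j))
    j≡0 : toℕ j ≡ 0
    j≡0 = n≤0⇒n≡0 (+-cancelˡ-≤ m (toℕ j) 0 (subst₂ _≤_ i→m+j (sym (+-identityʳ m)) (toℕ<n i)))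

no-step-back : ∀ {m n} (i : Fin n) (j : Fin m) → suc (toℕ (m ↑ʳ i)) ≢ toℕ (j ↑ˡ n)
no-step-back {m} {n} i j i→j = <⇒≱ (toℕ<n j) (subst (m ≤_) m+i→j (m≤n⇒m≤1+n (m≤m+n m (toℕ i))))
  where
    m+i→j : suc (m + toℕ i) ≡ toℕ j
    m+i→j = trans (cong suc (sym (toℕ-↑ʳ m i))) (trans i→j (toℕ-↑ˡ j n))

Near-sym : ∀ {n} {i j : Fin n} → Near i j → Near j i
Near-sym (inj₁ i≡j)        = inj₁ (sym i≡j)
Near-sym (inj₂ (inj₁ i→j)) = inj₂ (inj₂ (sym i→j))
Near-sym (inj₂ (inj₂ j→i)) = inj₂ (inj₁ (sym j→i))

alternate : Bool → ℕ → Bool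
alternate s zero    = s
alternate s (suc t) = not (alternate s t)

alternate-not : ∀ s t → alternate (not s) t ≡ not (alternate s t)
alternate-not s zero    = refl
alternate-not s (suc t) = cong not (alternate-not s t)

sumFin-≥ : ∀ {l} (f : Fin l → ℕ) i → f i ≤ sumFin f
sumFin-≥ f zero    = m≤m+n (f zero) _
sumFin-≥ f (suc i) = ≤-trans (sumFin-≥ (λ j → f (suc j)) i) (m≤n+m _ (f zero))

crossing-length : ∀ p q s t → p + q ≡ 2 → p + (s + s + (q + (t + t))) ≡ 2 * suc (s + t)
crossing-length p q s t p+q≡2 = begin
  p + (s + s + (q + (t + t))) ≡⟨ shuffle p q s t ⟩
  (p + q) + 2 * (s + t)       ≡⟨ cong (_+ 2 * (s + t)) p+q≡2 ⟩
  2 + 2 * (s + t)             ≡⟨ *-suc 2 (s + t) ⟨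
  2 * suc (s + t)             ∎
  where
    open ≡-Reasoning
    shuffle : ∀ p q s t → p + (s + s + (q + (t + t))) ≡ (p + q) + 2 * (s + t)
    shuffle = solve-∀

sum-peel : ∀ {k S o₁ o₂} → k ≤ o₁ → k + S ≡ o₁ + o₂ → S ≡ o₁ ∸ k + o₂
sum-peel {k} {S} {o₁} {o₂} k≤o₁ k+S≡ = +-cancelˡ-≡ k _ _ (begin
  k + S              ≡⟨ k+S≡ ⟩
  o₁ + o₂            ≡⟨ cong (_+ o₂) (m+[n∸m]≡n k≤o₁) ⟨
  k + (o₁ ∸ k) + o₂  ≡⟨ +-assoc k (o₁ ∸ k) o₂ ⟩
  k + (o₁ ∸ k + o₂)  ∎)
  where open ≡-Reasoning

too-few-rungs : ∀ {k S o₁ o₂} → k ≤ S → k + S ≡ o₁ + o₂ → o₁ < k → o₂ < k → ⊥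
too-few-rungs {k} k≤S k+S≡ o₁<k o₂<k =
  <-irrefl (sym k+S≡) (<-≤-trans (+-mono-< o₁<k o₂<k) (+-monoʳ-≤ k k≤S))

module Paths {V : Set} (E : V → V → Set) (E-sym : ∀ {u v} → E u v → E v u) where

  record IsPath {m} (xs : Vector V m) : Set where
    field
      injective : Injective _≡_ _≡_ xs
      linked    : ∀ {i j} → suc (toℕ i) ≡ toℕ j → E (xs i) (xs j)
  open IsPath

  IsCycle : ∀ {m} → Vector V m → Set
  IsCycle {m} xs = Injective _≡_ _≡_ xs × (∀ i j → CycleEdge m i j → E (xs i) (xs j))

  closePath : ∀ {m} {xs : Vector V m} → IsPath xs →
    (∀ {i j} → suc (toℕ i) ≡ m → toℕ j ≡ 0 → E (xs i) (xs j)) → IsCycle xs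
  closePath P closing = injective P , λ where
    i j (inj₁ i→j)           → linked P i→j
    i j (inj₂ (i-last , j≡0)) → closing i-last j≡0

  ++-isPath : ∀ {m n} {xs : Vector V m} {ys : Vector V n} → IsPath xs → IsPath ys →
    (∀ {i j} → suc (toℕ i) ≡ m → toℕ j ≡ 0 → E (xs i) (ys j)) →
    (∀ i j → xs i ≢ ys j) → IsPath (xs ++ ys)
  ++-isPath {m} {n} {xs} {ys} P Q junction disjoint = record { injective = inj ; linked = lnk }
    where
      atˡ : ∀ i → (xs ++ ys) (i ↑ˡ n) ≡ xs i
      atˡ = lookup-++ˡ xs ys
      atʳ : ∀ j → (xs ++ ys) (m ↑ʳ j) ≡ ys j
      atʳ = lookup-++ʳ xs ys
      inj : Injective _≡_ _≡_ (xs ++ ys)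
      inj {i} {j} eq with split m i | split m j
      ... | left i | left j = cong (_↑ˡ n) (injective P (trans (sym (atˡ i)) (trans eq (atˡ j))))
      ... | left i | right j = ⊥-elim (disjoint i j (trans (sym (atˡ i)) (trans eq (atʳ j))))
      ... | right i | left j = ⊥-elim (disjoint j i (trans (sym (atˡ j)) (trans (sym eq) (atʳ i))))
      ... | right i | right j = cong (m ↑ʳ_) (injective Q (trans (sym (atʳ i)) (trans eq (atʳ j))))
      lnk : ∀ {i j} → suc (toℕ i) ≡ toℕ j → E ((xs ++ ys) i) ((xs ++ ys) j)
      lnk {i} {j} i→j with split m i | split m j
      ... | left i  | left j  = subst₂ E (sym (atˡ i)) (sym (atˡ j)) (linked P (↑ˡ-step i j i→j))
      ... | left i  | right j = let i-last , j≡0 = seam-step i j i→j in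
                                subst₂ E (sym (atˡ i)) (sym (atʳ j)) (junction i-last j≡0)
      ... | right i | left j  = ⊥-elim (no-step-back i j i→j)
      ... | right i | right j = subst₂ E (sym (atʳ i)) (sym (atʳ j)) (linked Q (↑ʳ-step i j i→j))

  reverse-isPath : ∀ {m} {xs : Vector V m} → IsPath xs → IsPath (reverse xs)
  reverse-isPath P = record
    { injective = λ {i} {j} eq → trans (sym (opposite-involutive i))
                    (trans (cong opposite (injective P eq)) (opposite-involutive j))
    ; linked    = λ i→j → E-sym (linked P (opposite-step i→j))
    }

  ++-first : ∀ {m n} (xs : Vector V m) (ys : Vector V n) {i} → toℕ i ≡ 0 →
    (∃ λ j → toℕ j ≡ 0 × (xs ++ ys) i ≡ xs j) ⊎ (m ≡ 0 × ∃ λ j → toℕ j ≡ 0 × (xs ++ ys) i ≡ ys j)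
  ++-first {m} {n} xs ys {i} i≡0 with split m i
  ... | left j  = inj₁ (j , trans (sym (toℕ-↑ˡ j n)) i≡0 , lookup-++ˡ xs ys j)
  ... | right j = inj₂ (m+n≡0⇒m≡0 m m+j≡0 , j , m+n≡0⇒n≡0 m m+j≡0 , lookup-++ʳ xs ys j)
    where
      m+j≡0 : m + toℕ j ≡ 0
      m+j≡0 = trans (sym (toℕ-↑ʳ m j)) i≡0

  ++-last : ∀ {m n} (xs : Vector V m) (ys : Vector V n) {i} → 0 < n → suc (toℕ i) ≡ m + n →
    ∃ λ j → suc (toℕ j) ≡ n × (xs ++ ys) i ≡ ys j
  ++-last {m} {n} xs ys {i} 0<n i-last with split m i
  ... | right j = j
    , +-cancelˡ-≡ m _ _ (trans (+-suc m (toℕ j)) (trans (cong suc (sym (toℕ-↑ʳ m j))) i-last))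
    , lookup-++ʳ xs ys j
  ... | left j  = ⊥-elim (<⇒≱ (m<m+n m 0<n)
                    (subst (_≤ m) (trans (cong suc (sym (toℕ-↑ˡ j n))) i-last) (toℕ<n j)))

  ++-all : ∀ {m n} {P : V → Set} (xs : Vector V m) (ys : Vector V n) →
    (∀ i → P (xs i)) → (∀ j → P (ys j)) → ∀ i → P ((xs ++ ys) i)
  ++-all {m} xs ys Pxs Pys i with splitAt m i
  ... | inj₁ i′ = Pxs i′
  ... | inj₂ j  = Pys j

  record CycleIn (R : V → Set) (m : ℕ) : Set where
    constructor cycleIn
    field
      vertices : Vector V m
      isCycle  : IsCycle vertices
      inside   : ∀ i → R (vertices i)

  cycle-resize : ∀ {R m m′} → m ≡ m′ → CycleIn R m → CycleIn R m′
  cycle-resize refl C = C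

  cycle-weaken : ∀ {R S m} → R ⊆ S → CycleIn R m → CycleIn S m
  cycle-weaken R⊆S (cycleIn c isCycle inR) = cycleIn c isCycle λ i → R⊆S (inR i)

  record Packing (R : V → Set) {l} (len : Fin l → ℕ) : Set where
    constructor packing
    field
      embed     : Σ (Fin l) (λ i → Fin (len i)) → V
      injective : Injective _≡_ _≡_ embed
      edges     : ∀ i j k → CycleEdge (len i) j k → E (embed (i , j)) (embed (i , k))
      inside    : ∀ z → R (embed z)

  packing-weaken : ∀ {R S l} {len : Fin l → ℕ} → R ⊆ S → Packing R len → Packing S len
  packing-weaken R⊆S (packing F F-inj F-edges inR) = packing F F-inj F-edges λ z → R⊆S (inR z)

  packing-[] : ∀ {R} (len : Fin 0 → ℕ) → Packing R len
  packing-[] len = packing (λ ()) (λ { {() , _} }) (λ ()) (λ ())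

  packing-∷ : ∀ {R S l} {len : Fin (suc l) → ℕ} → CycleIn R (len zero) → Packing S (λ i → len (suc i)) →
    (∀ {v} → R v → S v → ⊥) → Packing (R ∪ S) len
  packing-∷ {R} {S} {l} {len} (cycleIn c (c-inj , c-edge) c-R) (packing F F-inj F-edge F-S) disjoint =
    packing F′ F′-inj F′-edge F′-RS
    where
      F′ : Σ (Fin (suc l)) (λ i → Fin (len i)) → V
      F′ (zero  , j) = c j
      F′ (suc i , j) = F (i , j)
      F′-inj : Injective _≡_ _≡_ F′
      F′-inj {zero  , j} {zero   , j′} eq = cong (zero ,_) (c-inj eq)
      F′-inj {zero  , j} {suc i′ , j′} eq = ⊥-elim (disjoint (c-R j) (subst S (sym eq) (F-S (i′ , j′))))
      F′-inj {suc i , j} {zero   , j′} eq = ⊥-elim (disjoint (c-R j′) (subst S eq (F-S (i , j))))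
      F′-inj {suc i , j} {suc i′ , j′} eq with F-inj eq
      ... | refl = refl
      F′-edge : ∀ i j k → CycleEdge (len i) j k → E (F′ (i , j)) (F′ (i , k))
      F′-edge zero    = c-edge
      F′-edge (suc i) = F-edge i
      F′-RS : ∀ z → (R ∪ S) (F′ z)
      F′-RS (zero  , j) = inj₁ (c-R j)
      F′-RS (suc i , j) = inj₂ (F-S (i , j))

  record Ladder (n : ℕ) : Set where
    field
      A B         : Fin n → V
      A-injective : Injective _≡_ _≡_ A
      B-injective : Injective _≡_ _≡_ B
      A≢B         : ∀ i j → A i ≢ B j
      adjacent    : ∀ {i j} → Near i j → E (A i) (B j)

    vertex : Bool → Fin n → V
    vertex true  = A
    vertex false = B

    vertex-injective : ∀ s s′ {i j} → vertex s i ≡ vertex s′ j → s ≡ s′ × i ≡ j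
    vertex-injective true  true  eq = refl , A-injective eq
    vertex-injective false false eq = refl , B-injective eq
    vertex-injective true  false eq = ⊥-elim (A≢B _ _ eq)
    vertex-injective false true  eq = ⊥-elim (A≢B _ _ (sym eq))

    vertex-adjacent : ∀ s {i j} → Near i j → E (vertex s i) (vertex (not s) j)
    vertex-adjacent true  near = adjacent near
    vertex-adjacent false near = E-sym (adjacent (Near-sym near))

    InRungs : ℕ → ℕ → V → Set
    InRungs lo hi v = ∃₂ λ s r → v ≡ vertex s r × lo ≤ toℕ r × toℕ r < hi

    module Zigzag (o k : ℕ) (o+k≤n : o + k ≤ n) where

      rung : Fin k → Fin n
      rung i = fromℕ< (≤-trans (+-monoʳ-< o (toℕ<n i)) o+k≤n)

      toℕ-rung : ∀ i → toℕ (rung i) ≡ o + toℕ i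
      toℕ-rung i = toℕ-fromℕ< _

      rung-injective : Injective _≡_ _≡_ rung
      rung-injective eq = toℕ-injective (+-cancelˡ-≡ o _ _
        (trans (sym (toℕ-rung _)) (trans (cong toℕ eq) (toℕ-rung _))))

      rung-step : ∀ {i j} → suc (toℕ i) ≡ toℕ j → suc (toℕ (rung i)) ≡ toℕ (rung j)
      rung-step {i} {j} i→j = begin
        suc (toℕ (rung i))  ≡⟨ cong suc (toℕ-rung i) ⟩
        suc (o + toℕ i)     ≡⟨ +-suc o (toℕ i) ⟨
        o + suc (toℕ i)     ≡⟨ cong (o +_) i→j ⟩
        o + toℕ j           ≡⟨ toℕ-rung j ⟨
        toℕ (rung j)        ∎
        where open ≡-Reasoning

      zigzag : Bool → Vector V k
      zigzag s i = vertex (alternate s (toℕ i)) (rung i)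

      zigzag-isPath : ∀ s → IsPath (zigzag s)
      zigzag-isPath s = record
        { injective = λ {i} {j} eq →
            rung-injective (proj₂ (vertex-injective (alternate s (toℕ i)) (alternate s (toℕ j)) eq))
        ; linked    = λ {i} {j} i→j → subst (λ t → E (zigzag s i) (vertex (alternate s t) (rung j))) i→j
            (vertex-adjacent (alternate s (toℕ i)) (inj₂ (inj₁ (rung-step i→j))))
        }

      zigzag-inRungs : ∀ s i → InRungs o (o + k) (zigzag s i)
      zigzag-inRungs s i = alternate s (toℕ i) , rung i , refl
        , subst (o ≤_) (sym (toℕ-rung i)) (m≤m+n o (toℕ i))
        , subst (_< o + k) (sym (toℕ-rung i)) (+-monoʳ-< o (toℕ<n i))

      zigzag-disjoint : ∀ i j → zigzag true i ≢ zigzag false j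
      zigzag-disjoint i j eq with vertex-injective (alternate true (toℕ i)) (alternate false (toℕ j)) eq
      ... | sides , rungs with rung-injective rungs
      ... | refl = not-¬ refl (trans sides (alternate-not true (toℕ i)))

      -- From A o up the rungs o, …, o+k-1 on alternating sides, then back down on the opposite
      -- sides to B o.
      path : Vector V (k + k)
      path = zigzag true ++ reverse (zigzag false)

      path-isPath : IsPath path
      path-isPath = ++-isPath (zigzag-isPath true) (reverse-isPath (zigzag-isPath false)) junction
        (λ i j → zigzag-disjoint i (opposite j))
        where
          junction : ∀ {i j} → suc (toℕ i) ≡ k → toℕ j ≡ 0 → E (zigzag true i) (zigzag false (opposite j))
          junction {i} {j} i-last j≡0 with toℕ-injective {i = opposite j} {j = i}
                                             (suc-injective (trans (first⇒opposite-last j j≡0) (sym i-last)))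
          ... | refl = subst (λ s → E (zigzag true (opposite j)) (vertex s (rung (opposite j))))
                         (sym (alternate-not true (toℕ (opposite j))))
                         (vertex-adjacent (alternate true (toℕ (opposite j))) (inj₁ refl))

      path-first : 0 < k → ∀ {i} → toℕ i ≡ 0 → ∃ λ r → toℕ r ≡ o × path i ≡ A r
      path-first 0<k i≡0 with ++-first (zigzag true) (reverse (zigzag false)) i≡0
      ... | inj₂ (k≡0 , _) = ⊥-elim (<-irrefl (sym k≡0) 0<k)
      ... | inj₁ (j , j≡0 , path≡) = rung j , trans (toℕ-rung j) (trans (cong (o +_) j≡0) (+-identityʳ o))
                                   , trans path≡ (cong (λ t → vertex (alternate true t) (rung j)) j≡0)

      path-last : 0 < k → ∀ {i} → suc (toℕ i) ≡ k + k → ∃ λ r → toℕ r ≡ o × path i ≡ B r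
      path-last 0<k i-last with ++-last (zigzag true) (reverse (zigzag false)) 0<k i-last
      ... | j , j-last , path≡ = rung (opposite j)
        , trans (toℕ-rung (opposite j)) (trans (cong (o +_) j≡0) (+-identityʳ o))
        , trans path≡ (cong (λ t → vertex (alternate false t) (rung (opposite j))) j≡0)
        where
          j≡0 : toℕ (opposite j) ≡ 0
          j≡0 = last⇒opposite-first j j-last

      path-inRungs : ∀ i → InRungs o (o + k) (path i)
      path-inRungs = ++-all {P = InRungs o (o + k)} (zigzag true) (reverse (zigzag false))
        (zigzag-inRungs true) (λ j → zigzag-inRungs false (opposite j))

      cycle : 0 < k → CycleIn (InRungs o (o + k)) (2 * k)
      cycle 0<k = cycle-resize (cong (k +_) (sym (+-identityʳ k)))
        (cycleIn path (closePath path-isPath closing) path-inRungs)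
        where
          closing : ∀ {i j} → suc (toℕ i) ≡ k + k → toℕ j ≡ 0 → E (path i) (path j)
          closing i-last j≡0 with path-last 0<k i-last | path-first 0<k j≡0
          ... | r , r≡o , path-i≡ | r′ , r′≡o , path-j≡ with toℕ-injective (trans r≡o (sym r′≡o))
          ... | refl = subst₂ E (sym path-i≡) (sym path-j≡) (vertex-adjacent false (inj₁ refl))

module WeakLadder (m1 m2 p q : ℕ) where

  V : Set
  V = WLVertex m1 m2 p q

  E : V → V → Set
  E u v = WLEdge u v ⊎ WLEdge v u

  E-sym : ∀ {u v} → E u v → E v u
  E-sym (inj₁ e) = inj₂ e
  E-sym (inj₂ e) = inj₁ e

  open Paths E E-sym public

  L₁ : Ladder (suc m1)
  L₁ = record
    { A = a ; B = b
    ; A-injective = λ { refl → refl } ; B-injective = λ { refl → refl }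
    ; A≢B = λ _ _ () ; adjacent = λ near → inj₁ (ladder₁ _ _ near) }

  L₂ : Ladder (suc m2)
  L₂ = record
    { A = a' ; B = b'
    ; A-injective = λ { refl → refl } ; B-injective = λ { refl → refl }
    ; A≢B = λ _ _ () ; adjacent = λ near → inj₁ (ladder₂ _ _ near) }

  module L₁ = Ladder L₁
  module L₂ = Ladder L₂

  -- What the greedy packing has not used yet: the first o₁ rungs of L_{n_1}, the first o₂ rungs
  -- of L_{n_2}, and the interiors of P₁ and P₂.
  Available : ℕ → ℕ → V → Set
  Available o₁ o₂ (a i)  = toℕ i < o₁
  Available o₁ o₂ (b i)  = toℕ i < o₁
  Available o₁ o₂ (a' i) = toℕ i < o₂
  Available o₁ o₂ (b' i) = toℕ i < o₂
  Available o₁ o₂ (x _)  = ⊤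
  Available o₁ o₂ (y _)  = ⊤

  Available-mono : ∀ {o₁ o₂ o₁′ o₂′} → o₁ ≤ o₁′ → o₂ ≤ o₂′ → Available o₁ o₂ ⊆ Available o₁′ o₂′
  Available-mono o₁≤ o₂≤ {a _}  i<o₁ = <-≤-trans i<o₁ o₁≤
  Available-mono o₁≤ o₂≤ {b _}  i<o₁ = <-≤-trans i<o₁ o₁≤
  Available-mono o₁≤ o₂≤ {a' _} i<o₂ = <-≤-trans i<o₂ o₂≤
  Available-mono o₁≤ o₂≤ {b' _} i<o₂ = <-≤-trans i<o₂ o₂≤
  Available-mono o₁≤ o₂≤ {x _}  _    = tt
  Available-mono o₁≤ o₂≤ {y _}  _    = tt

  rungs₁-available : ∀ {lo hi o₁ o₂} → hi ≤ o₁ → L₁.InRungs lo hi ⊆ Available o₁ o₂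
  rungs₁-available hi≤o₁ (true  , r , refl , _ , r<hi) = <-≤-trans r<hi hi≤o₁
  rungs₁-available hi≤o₁ (false , r , refl , _ , r<hi) = <-≤-trans r<hi hi≤o₁

  rungs₂-available : ∀ {lo hi o₁ o₂} → hi ≤ o₂ → L₂.InRungs lo hi ⊆ Available o₁ o₂
  rungs₂-available hi≤o₂ (true  , r , refl , _ , r<hi) = <-≤-trans r<hi hi≤o₂
  rungs₂-available hi≤o₂ (false , r , refl , _ , r<hi) = <-≤-trans r<hi hi≤o₂

  rungs₁-unavailable : ∀ {lo hi o₂ v} → L₁.InRungs lo hi v → Available lo o₂ v → ⊥
  rungs₁-unavailable (true  , r , refl , lo≤r , _) r<lo = <⇒≱ r<lo lo≤r
  rungs₁-unavailable (false , r , refl , lo≤r , _) r<lo = <⇒≱ r<lo lo≤r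

  rungs₂-unavailable : ∀ {lo hi o₁ v} → L₂.InRungs lo hi v → Available o₁ lo v → ⊥
  rungs₂-unavailable (true  , r , refl , lo≤r , _) r<lo = <⇒≱ r<lo lo≤r
  rungs₂-unavailable (false , r , refl , lo≤r , _) r<lo = <⇒≱ r<lo lo≤r

  data Part : Set where
    onL₁ onL₂ onP₁ onP₂ : Part

  part : V → Part
  part (a _)  = onL₁
  part (b _)  = onL₁
  part (a' _) = onL₂
  part (b' _) = onL₂
  part (x _)  = onP₁
  part (y _)  = onP₂

  rungs₁-part : ∀ {lo hi v} → L₁.InRungs lo hi v → part v ≡ onL₁
  rungs₁-part (true  , _ , refl , _) = refl
  rungs₁-part (false , _ , refl , _) = refl

  rungs₂-part : ∀ {lo hi v} → L₂.InRungs lo hi v → part v ≡ onL₂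
  rungs₂-part (true  , _ , refl , _) = refl
  rungs₂-part (false , _ , refl , _) = refl

  part-≢ : ∀ {v c c′} → part v ≡ c → c ≢ c′ → part v ≢ c′
  part-≢ refl c≢c′ = c≢c′

  apart : ∀ {u v c} → part u ≡ c → part v ≢ c → u ≢ v
  apart part-u part-v u≡v = part-v (trans (cong part (sym u≡v)) part-u)

  x-isPath : IsPath x
  x-isPath = record
    { injective = λ { refl → refl } ; linked = λ {i} {j} i→j → inj₁ (path₁-step i j i→j) }

  y-isPath : IsPath y
  y-isPath = record
    { injective = λ { refl → refl } ; linked = λ {i} {j} i→j → inj₁ (path₂-step i j i→j) }

  module Crossing {s t : ℕ} (0<s : 0 < s) (0<t : 0 < t) (s≤ : s ≤ suc m1) (t≤ : t ≤ suc m2) where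

    module Z₁ = L₁.Zigzag 0 s s≤
    module Z₂ = L₂.Zigzag 0 t t≤

    on-Z₁ : ∀ i → part (Z₁.path i) ≡ onL₁
    on-Z₁ i = rungs₁-part (Z₁.path-inRungs i)
    on-Z₂ : ∀ i → part (Z₂.path i) ≡ onL₂
    on-Z₂ i = rungs₂-part (Z₂.path-inRungs i)

    inner : Vector V (q + (t + t))
    inner = y ++ reverse Z₂.path
    outer : Vector V (s + s + (q + (t + t)))
    outer = Z₁.path ++ inner
    -- x_{p-1}, …, x_0, then a_0 ⇝ b_0 in L_{n_1}, then y_0, …, y_{q-1}, then b'_0 ⇝ a'_0 in L_{n_2}.
    cycle : Vector V (p + (s + s + (q + (t + t))))
    cycle = reverse x ++ outer

    0<t+t : 0 < t + t
    0<t+t = ≤-trans 0<t (m≤m+n t t)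
    0<inner : 0 < q + (t + t)
    0<inner = ≤-trans 0<t+t (m≤n+m _ q)
    0<outer : 0 < s + s + (q + (t + t))
    0<outer = ≤-trans 0<inner (m≤n+m _ (s + s))

    first₁ : ∀ {i} → toℕ i ≡ 0 → Z₁.path i ≡ a zero
    first₁ i≡0 with Z₁.path-first 0<s i≡0
    ... | r , r≡0 , path≡ = trans path≡ (cong a (toℕ-injective r≡0))
    last₁ : ∀ {i} → suc (toℕ i) ≡ s + s → Z₁.path i ≡ b zero
    last₁ i-last with Z₁.path-last 0<s i-last
    ... | r , r≡0 , path≡ = trans path≡ (cong b (toℕ-injective r≡0))
    first₂ : ∀ {i} → toℕ i ≡ 0 → Z₂.path i ≡ a' zero
    first₂ i≡0 with Z₂.path-first 0<t i≡0
    ... | r , r≡0 , path≡ = trans path≡ (cong a' (toℕ-injective r≡0))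
    last₂ : ∀ {i} → suc (toℕ i) ≡ t + t → Z₂.path i ≡ b' zero
    last₂ i-last with Z₂.path-last 0<t i-last
    ... | r , r≡0 , path≡ = trans path≡ (cong b' (toℕ-injective r≡0))

    outer-first : ∀ {i} → toℕ i ≡ 0 → outer i ≡ a zero
    outer-first i≡0 with ++-first Z₁.path inner i≡0
    ... | inj₁ (j , j≡0 , outer≡) = trans outer≡ (first₁ j≡0)
    ... | inj₂ (s+s≡0 , _) = ⊥-elim (<-irrefl (sym s+s≡0) (≤-trans 0<s (m≤m+n s s)))

    cycle-last : ∀ {i} → suc (toℕ i) ≡ p + (s + s + (q + (t + t))) → cycle i ≡ a' zero
    cycle-last i-last with ++-last (reverse x) outer 0<outer i-last
    ... | j , j-last , cycle≡ with ++-last Z₁.path inner 0<inner j-last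
    ... | k , k-last , outer≡ with ++-last y (reverse Z₂.path) 0<t+t k-last
    ... | l , l-last , inner≡ =
          trans cycle≡ (trans outer≡ (trans inner≡ (first₂ (last⇒opposite-first l l-last))))

    inner-isPath : IsPath inner
    inner-isPath = ++-isPath y-isPath (reverse-isPath Z₂.path-isPath)
      (λ {i} {j} i-last j≡0 →
         subst (E (y i)) (sym (last₂ (first⇒opposite-last j j≡0))) (inj₁ (path₂-last i i-last)))
      (λ i j → apart refl (part-≢ (on-Z₂ (opposite j)) λ ()))

    b₀-inner : ∀ {j} → toℕ j ≡ 0 → E (b zero) (inner j)
    b₀-inner j≡0 with ++-first y (reverse Z₂.path) j≡0
    ... | inj₁ (k , k≡0 , inner≡) = subst (E (b zero)) (sym inner≡) (inj₁ (path₂-first k k≡0))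
    ... | inj₂ (q≡0 , k , k≡0 , inner≡) =
          subst (E (b zero)) (sym (trans inner≡ (last₂ (first⇒opposite-last k k≡0))))
                (inj₁ (path₂-empty q≡0))

    inner-off-L₁ : ∀ j → part (inner j) ≢ onL₁
    inner-off-L₁ = ++-all {P = λ v → part v ≢ onL₁} y (reverse Z₂.path) (λ _ ())
      (λ j → part-≢ (on-Z₂ (opposite j)) λ ())

    outer-isPath : IsPath outer
    outer-isPath = ++-isPath Z₁.path-isPath inner-isPath
      (λ {i} {j} i-last j≡0 → subst (λ v → E v (inner j)) (sym (last₁ i-last)) (b₀-inner j≡0))
      (λ i j → apart (on-Z₁ i) (inner-off-L₁ j))

    outer-off-P₁ : ∀ j → part (outer j) ≢ onP₁
    outer-off-P₁ = ++-all {P = λ v → part v ≢ onP₁} Z₁.path inner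
      (λ i → part-≢ (on-Z₁ i) λ ())
      (++-all {P = λ v → part v ≢ onP₁} y (reverse Z₂.path) (λ _ ())
        (λ j → part-≢ (on-Z₂ (opposite j)) λ ()))

    cycle-isPath : IsPath cycle
    cycle-isPath = ++-isPath (reverse-isPath x-isPath) outer-isPath
      (λ {i} {j} i-last j≡0 → subst (E (x (opposite i))) (sym (outer-first j≡0))
                                (inj₂ (path₁-first (opposite i) (last⇒opposite-first i i-last))))
      (λ i j → apart refl (outer-off-P₁ j))

    a'₀-cycle : ∀ {j} → toℕ j ≡ 0 → E (a' zero) (cycle j)
    a'₀-cycle j≡0 with ++-first (reverse x) outer j≡0
    ... | inj₁ (k , k≡0 , cycle≡) =
          subst (E (a' zero)) (sym cycle≡) (inj₂ (path₁-last (opposite k) (first⇒opposite-last k k≡0)))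
    ... | inj₂ (p≡0 , k , k≡0 , cycle≡) =
          subst (E (a' zero)) (sym (trans cycle≡ (outer-first k≡0))) (inj₂ (path₁-empty p≡0))

    closing : ∀ {i j} → suc (toℕ i) ≡ p + (s + s + (q + (t + t))) → toℕ j ≡ 0 → E (cycle i) (cycle j)
    closing {i} {j} i-last j≡0 = subst (λ v → E v (cycle j)) (sym (cycle-last i-last)) (a'₀-cycle j≡0)

    cycle-available : ∀ i → Available s t (cycle i)
    cycle-available = ++-all {P = Available s t} (reverse x) outer (λ _ → tt)
      (++-all {P = Available s t} Z₁.path inner (λ i → rungs₁-available ≤-refl (Z₁.path-inRungs i))
        (++-all {P = Available s t} y (reverse Z₂.path) (λ _ → tt)
          (λ j → rungs₂-available ≤-refl (Z₂.path-inRungs (opposite j)))))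

    crossingCycle : p + q ≡ 2 → CycleIn (Available s t) (2 * suc (s + t))
    crossingCycle p+q≡2 = cycle-resize (crossing-length p q s t p+q≡2)
      (cycleIn cycle (closePath cycle-isPath closing) cycle-available)

  fullCycle : p + q ≡ 2 → ∀ {o₁ o₂} → o₁ ≤ suc m1 → o₂ ≤ suc m2 → 3 ≤ o₁ + o₂ →
    CycleIn (Available o₁ o₂) (2 * (o₁ + o₂))
  fullCycle _ {zero} {o₂} _ o₂≤ 3≤o₂ =
    cycle-weaken (rungs₂-available ≤-refl) (L₂.Zigzag.cycle 0 o₂ o₂≤ (≤-trans (s≤s z≤n) 3≤o₂))
  fullCycle _ {suc s} {zero} o₁≤ _ _ = cycle-resize (cong (2 *_) (sym (+-identityʳ (suc s))))
    (cycle-weaken (rungs₁-available ≤-refl) (L₁.Zigzag.cycle 0 (suc s) o₁≤ (s≤s z≤n)))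
  fullCycle p+q≡2 {suc (suc s)} {suc t} o₁≤ o₂≤ _ =
    cycle-weaken (Available-mono (n≤1+n _) ≤-refl)
      (Crossing.crossingCycle (s≤s z≤n) (s≤s z≤n) (≤-trans (n≤1+n _) o₁≤) o₂≤ p+q≡2)
  fullCycle p+q≡2 {suc zero} {suc (suc t)} o₁≤ o₂≤ _ =
    cycle-weaken (Available-mono ≤-refl (n≤1+n _))
      (Crossing.crossingCycle (s≤s z≤n) (s≤s z≤n) o₁≤ (≤-trans (n≤1+n _) o₂≤) p+q≡2)
  fullCycle _ {suc zero} {suc zero} _ _ (s≤s (s≤s ()))

  peel₁ : ∀ {l} {len : Fin (suc l) → ℕ} {o₁ o₂} → 0 < len zero → len zero ≤ o₁ → o₁ ≤ suc m1 →
    Packing (Available (o₁ ∸ len zero) o₂) (λ i → 2 * len (suc i)) →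
    Packing (Available o₁ o₂) (λ i → 2 * len i)
  peel₁ {len = len} {o₁} 0<k k≤o₁ o₁≤ rest = packing-weaken
    (λ { (inj₁ inRungs) → rungs₁-available (≤-reflexive (m∸n+n≡m k≤o₁)) inRungs
       ; (inj₂ available) → Available-mono (m∸n≤m o₁ (len zero)) ≤-refl available })
    (packing-∷ (L₁.Zigzag.cycle (o₁ ∸ len zero) (len zero)
                  (subst (_≤ suc m1) (sym (m∸n+n≡m k≤o₁)) o₁≤) 0<k)
               rest rungs₁-unavailable)

  peel₂ : ∀ {l} {len : Fin (suc l) → ℕ} {o₁ o₂} → 0 < len zero → len zero ≤ o₂ → o₂ ≤ suc m2 →
    Packing (Available o₁ (o₂ ∸ len zero)) (λ i → 2 * len (suc i)) →
    Packing (Available o₁ o₂) (λ i → 2 * len i)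
  peel₂ {len = len} {o₂ = o₂} 0<k k≤o₂ o₂≤ rest = packing-weaken
    (λ { (inj₁ inRungs) → rungs₂-available (≤-reflexive (m∸n+n≡m k≤o₂)) inRungs
       ; (inj₂ available) → Available-mono ≤-refl (m∸n≤m o₂ (len zero)) available })
    (packing-∷ (L₂.Zigzag.cycle (o₂ ∸ len zero) (len zero)
                  (subst (_≤ suc m2) (sym (m∸n+n≡m k≤o₂)) o₂≤) 0<k)
               rest rungs₂-unavailable)

  greedyPacking : p + q ≡ 2 → ∀ l (len : Fin (suc l) → ℕ) {o₁ o₂} → o₁ ≤ suc m1 → o₂ ≤ suc m2 →
    sumFin len ≡ o₁ + o₂ → (∀ i → 2 ≤ len i) → (∀ i → len i ≤ len (fromℕ l)) → 3 ≤ len (fromℕ l) →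
    Packing (Available o₁ o₂) (λ i → 2 * len i)
  greedyPacking p+q≡2 zero len o₁≤ o₂≤ sum≡ _ _ 3≤k =
    packing-weaken (λ { (inj₁ available) → available ; (inj₂ ()) })
      (packing-∷ {S = λ _ → ⊥}
        (cycle-resize (cong (2 *_) (sym k≡)) (fullCycle p+q≡2 o₁≤ o₂≤ (subst (3 ≤_) k≡ 3≤k)))
        (packing-[] _) (λ _ ()))
    where
      k≡ : len zero ≡ _
      k≡ = trans (sym (+-identityʳ (len zero))) sum≡
  greedyPacking p+q≡2 (suc l) len {o₁} {o₂} o₁≤ o₂≤ sum≡ 2≤ ≤last 3≤last
    with len zero ≤? o₁ | len zero ≤? o₂
  ... | yes k≤o₁ | _ = peel₁ {len = len} (<-≤-trans z<s (2≤ zero)) k≤o₁ o₁≤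
        (greedyPacking p+q≡2 l (λ i → len (suc i)) (≤-trans (m∸n≤m o₁ (len zero)) o₁≤) o₂≤
              (sum-peel k≤o₁ sum≡)
              (λ i → 2≤ (suc i)) (λ i → ≤last (suc i)) 3≤last)
  ... | no _ | yes k≤o₂ = peel₂ {len = len} (<-≤-trans z<s (2≤ zero)) k≤o₂ o₂≤
        (greedyPacking p+q≡2 l (λ i → len (suc i)) o₁≤ (≤-trans (m∸n≤m o₂ (len zero)) o₂≤)
              (trans (sum-peel k≤o₂ (trans sum≡ (+-comm o₁ o₂))) (+-comm _ o₁))
              (λ i → 2≤ (suc i)) (λ i → ≤last (suc i)) 3≤last)
  ... | no k≰o₁ | no k≰o₂ = ⊥-elim (too-few-rungs
        (≤-trans (≤last zero) (sumFin-≥ (λ i → len (suc i)) (fromℕ l))) sum≡ (≰⇒> k≰o₁) (≰⇒> k≰o₂))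

packing⇒disjointCycles : ∀ {N} (G : SimpleGraph N) {m1 m2 p q} (f : WLVertex m1 m2 p q → Fin N) →
  Injective _≡_ _≡_ f → (∀ {u v} → WLEdge u v → Adj G (f u) (f v)) →
  ∀ {R l} {len : Fin l → ℕ} → WeakLadder.Packing m1 m2 p q R len → ContainsDisjointCycles G len
packing⇒disjointCycles G f f-inj f-edge (WeakLadder.packing F F-inj F-edges _) =
  (λ z → f (F z)) , (λ eq → F-inj (f-inj eq)) , λ i j k c → adj (F-edges i j k c)
  where
    adj : ∀ {u v} → WLEdge u v ⊎ WLEdge v u → Adj G (f u) (f v)
    adj (inj₁ e) = f-edge e
    adj (inj₂ e) = symm G (f-edge e)

lemma3p3 : ∀ {N} (G : SimpleGraph N) (l : ℕ) (ns : Fin l → ℕ)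
    → (∀ i → 2 ≤ ns i)
    → (∀ i j → i Data.Fin.≤ j → ns i ≤ ns j)
    → ContainsWeakLadder G (sumFin ns) 1
    → ∃ (λ i → 2 < ns i)
    → ContainsDisjointCycles G (λ i → 2 * ns i)
lemma3p3 G zero ns _ _ _ (() , _)
lemma3p3 G (suc l) ns 2≤ sorted (m1 , m2 , p , q , _ , sum≡ , p+q≡2 , f , f-inj , f-edge) (i , 2<nᵢ) =
  packing⇒disjointCycles G f f-inj f-edge
    (WeakLadder.greedyPacking m1 m2 p q p+q≡2 l ns ≤-refl ≤-refl (sym sum≡) 2≤ ≤last (≤-trans 2<nᵢ (≤last i)))
  where
    ≤last : ∀ j → ns j ≤ ns (fromℕ l)
    ≤last j = sorted j (fromℕ l) (≤fromℕ j)
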